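{- Let $\mathcal T$ be a chair tiling, normalized so that all tile corners lie in $\mathbb{Z}^2$, and let $G_1$ be the graph whose vertex set is $\mathbb{Z}^2$ (equivalently, the set of integer points lying on boundaries of tiles; every tile then has exactly $8$ vertices on its boundary) and in which two vertices are adjacent iff they are at distance $1$ and the unit segment joining them is contained in the boundary of some tile. Then every vertex of $G_1$ has a degree different from the degrees of all its neighbours. Consequently, for each $c\in\{1,2,3\}$, the constant weight function $w\equiv c$ on the edges of $G_1$ is a solution to the 1-2-3 problem for $G_1$.
   Context: Let $L_0=([0,1]\times[0,2])\cup([0,2]\times[0,1])$ (an L-shaped tromino made of three unit squares). Define the substitution $\sigma$ by $\sigma(L_0)=\{L_0,\ L_0+(1,1),\ A,\ B\}$ where $A=[2,4]\times[0,1]\cup[3,4]\times[0,2]$ and $B=[0,1]\times[2,4]\cup[0,2]\times[3,4]$ (these four L-trominoes tile $2L_0$), and for an isometric copy $\varphi(L_0)$ with $\varphi(x)=Qx+b$ ($Q$ orthogonal) set $\sigma(\varphi(L_0))=\{\psi(P):P\in\sigma(L_0)\}$ where $\psi(x)=Qx+2b$; extend $\sigma$ to sets of tiles tilewise. A chair tiling is a tiling of $\mathbb{R}^2$ by isometric copies of $L_0$ (tiles meeting only on boundaries) such that every finite set of its tiles is a translate of a subset of $\sigma^n(\{L_0\})$ for some $n\ge0$. For a graph $G=(V,E)$ and $w:E\to\{1,2,3\}$, the weighted degree of $u$ is $s_w(u)=\sum_{uv\in E}w(uv)$; $w$ is a solution to the 1-2-3 problem if $s_w(u)\neq s_w(v)$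 for every edge $uv$. -}

module Defs where

open import Data.Nat as ℕ using (ℕ; zero; suc)
open import Data.Integer as ℤ using (ℤ; +_; -_)
open import Data.Product using (Σ; ∃; ∃-syntax; _×_; _,_; proj₁; proj₂)
open import Data.Sum using (_⊎_)
open import Data.List using (List; []; _∷_; map; concatMap; length)
open import Data.Nat.ListAction using (sum)
open import Data.List.Relation.Unary.All using (All)
open import Data.List.Relation.Unary.Any using (Any)
open import Data.List.Membership.Propositional using (_∈_)
open import Data.List.Relation.Unary.Unique.Propositional using (Unique)
open import Relation.Binary.PropositionalEquality using (_≡_; _≢_)
open import Function.Bundles using (_⇔_)

Pt : Set
Pt = ℤ × ℤ

_⊕_ : Pt → Pt → Pt
(a , b) ⊕ (c , d) = (a ℤ.+ c , b ℤ.+ d)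

dbl : Pt → Pt
dbl (a , b) = (+ 2 ℤ.* a , + 2 ℤ.* b)

record Mat : Set where
  constructor mat
  field
    a b c d : ℤ
open Mat public

_·_ : Mat → Pt → Pt
M · (x , y) = (a M ℤ.* x ℤ.+ b M ℤ.* y , c M ℤ.* x ℤ.+ d M ℤ.* y)

_∘M_ : Mat → Mat → Mat
M ∘M N = mat (a M ℤ.* a N ℤ.+ b M ℤ.* c N) (a M ℤ.* b N ℤ.+ b M ℤ.* d N)
             (c M ℤ.* a N ℤ.+ d M ℤ.* c N) (c M ℤ.* b N ℤ.+ d M ℤ.* d N)

Orthogonal : Mat → Set
Orthogonal M = (a M ℤ.* a M ℤ.+ c M ℤ.* c M ≡ + 1)
             × (b M ℤ.* b M ℤ.+ d M ℤ.* d M ≡ + 1)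
             × (a M ℤ.* b M ℤ.+ c M ℤ.* d M ≡ + 0)

I₂ : Mat
I₂ = mat (+ 1) (+ 0) (+ 0) (+ 1)

-- Tiles: a tile φ(L₀) with φ(x) = Q x + b, Q orthogonal, b ∈ ℤ²
-- (corners in ℤ² forces Q integral and b integral).

record Tile : Set where
  constructor tile
  field
    Q : Mat
    b : Pt
open Tile public

φ : Tile → Pt → Pt
φ t x = (Q t · x) ⊕ b t

L₀ : Tile
L₀ = tile I₂ (+ 0 , + 0)

-- unit cells [i,i+1]×[j,j+1] are encoded by their doubled centre (2i+1,2j+1);
-- the image of a unit cell with doubled centre p under φ has doubled centre Q p + 2b
cellCode : Pt → Pt
cellCode (i , j) = (+ 2 ℤ.* i ℤ.+ + 1 , + 2 ℤ.* j ℤ.+ + 1)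

L₀cells : List Pt
L₀cells = map cellCode ((+ 0 , + 0) ∷ (+ 1 , + 0) ∷ (+ 0 , + 1) ∷ [])

cells : Tile → List Pt
cells t = map (λ p → (Q t · p) ⊕ dbl (b t)) L₀cells

L₀boundary : List (Pt × Pt)
L₀boundary =
    ((+ 0 , + 0) , (+ 1 , + 0)) ∷ ((+ 1 , + 0) , (+ 2 , + 0))
  ∷ ((+ 2 , + 0) , (+ 2 , + 1)) ∷ ((+ 2 , + 1) , (+ 1 , + 1))
  ∷ ((+ 1 , + 1) , (+ 1 , + 2)) ∷ ((+ 1 , + 2) , (+ 0 , + 2))
  ∷ ((+ 0 , + 2) , (+ 0 , + 1)) ∷ ((+ 0 , + 1) , (+ 0 , + 0)) ∷ []

boundarySegs : Tile → List (Pt × Pt)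
boundarySegs t = map (λ s → (φ t (proj₁ s) , φ t (proj₂ s))) L₀boundary

-- two tile descriptions denote the same subset of ℝ²
SameTile : Tile → Tile → Set
SameTile t t' = ∀ p → (p ∈ cells t) ⇔ (p ∈ cells t')

translate : Pt → Tile → Tile
translate v t = tile (Q t) (b t ⊕ v)

-- A = [2,4]×[0,1] ∪ [3,4]×[0,2] = diag(-1,1) L₀ + (4,0)
-- B = [0,1]×[2,4] ∪ [0,2]×[3,4] = diag(1,-1) L₀ + (0,4)
σL₀ : List Tile
σL₀ = L₀
    ∷ tile I₂ (+ 1 , + 1)
    ∷ tile (mat (- + 1) (+ 0) (+ 0) (+ 1)) (+ 4 , + 0)
    ∷ tile (mat (+ 1) (+ 0) (+ 0) (- + 1)) (+ 0 , + 4)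
    ∷ []

-- σ(φ(L₀)) = { ψ(P) : P ∈ σ(L₀) },  ψ(x) = Q x + 2b
σ : Tile → List Tile
σ t = map (λ P → tile (Q t ∘M Q P) ((Q t · b P) ⊕ dbl (b t))) σL₀

σ^ : ℕ → List Tile
σ^ zero    = L₀ ∷ []
σ^ (suc n) = concatMap σ (σ^ n)

-- Chair tilings (normalised: all corners in ℤ²), given as the predicate
-- "t is a tile of the tiling" on tile descriptions.

record ChairTiling (T : Tile → Set) : Set where
  field
    isometric : ∀ t → T t → Orthogonal (Q t)
    -- covers ℝ²: every unit cell lies in some tile
    covers    : ∀ (c : Pt) → ∃[ t ] (T t × cellCode c ∈ cells t)
    -- tiles meet only on boundaries: distinct tiles share no unit cell
    disjoint  : ∀ t t' → T t → T t' → ∀ p → p ∈ cells t → p ∈ cells t' → SameTile t t'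
    chair     : ∀ (F : List Tile) → All T F →
                ∃[ n ] ∃[ v ] All (λ t → Any (λ s → SameTile t (translate v s)) (σ^ n)) F

UnitApart : Pt → Pt → Set
UnitApart u v = (v ≡ u ⊕ (+ 1 , + 0)) ⊎ (v ≡ u ⊕ (- + 1 , + 0))
              ⊎ (v ≡ u ⊕ (+ 0 , + 1)) ⊎ (v ≡ u ⊕ (+ 0 , - + 1))

G₁ : (Tile → Set) → Pt → Pt → Set
G₁ T u v = UnitApart u v ×
           ∃[ t ] (T t × Any (λ s → (proj₁ s ≡ u × proj₂ s ≡ v) ⊎ (proj₁ s ≡ v × proj₂ s ≡ u))
                             (boundarySegs t))

NeighbourList : (Pt → Pt → Set) → Pt → List Pt → Set
NeighbourList E u ns = Unique ns × (∀ v → E u v ⇔ (v ∈ ns))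

Degree : (Pt → Pt → Set) → Pt → ℕ → Set
Degree E u k = ∃[ ns ] (NeighbourList E u ns × length ns ≡ k)

WeightedDegree : (Pt → Pt → Set) → (Pt → Pt → ℕ) → Pt → ℕ → Set
WeightedDegree E w u s = ∃[ ns ] (NeighbourList E u ns × s ≡ sum (map (w u) ns))

Solution123 : (Pt → Pt → Set) → (Pt → Pt → ℕ) → Set
Solution123 E w =
    (∀ u v → E u v → w u v ≡ w v u)
  × (∀ u v → E u v → (1 ℕ.≤ w u v) × (w u v ℕ.≤ 3))
  × (∀ u v → E u v → ∀ s s' → WeightedDegree E w u s → WeightedDegree E w v s' → s ≢ s')

module Submission where

-- The degree of a vertex of G₁ is the number of its four unit edges that separate two different
-- tiles, so it is determined by the three unit cells below-left, below-right and above-left of it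
-- together with the information which of their neighbours lie in the same tile.  Every finite
-- patch of a chair tiling is a translate of a patch of σⁿ(L₀), where this information is a
-- function of a finite "cell type" (orientation of the tile and position of the cell in it), and
-- the cell types of σⁿ⁺¹(L₀) are obtained from those of σⁿ(L₀) by a substitution on cells.  The 3×3 patches of cell types occurring in some σⁿ(L₀)
-- form a set of 165 windows, closed under substitution, and an exhaustive check on these windows
-- shows that two vertices joined by an edge of G₁ never have the same degree.  Constant weights
-- multiply all degrees by the same nonzero constant.

open import Defs
open import Data.Nat using (ℕ; _≤_)
open import Data.Product using (_×_; ∃-syntax)
open import Relation.Binary.PropositionalEquality using (_≢_)

open import Data.Bool using (Bool; true; false; not; _∨_; T)
open import Data.Bool.Properties using (T?; T-not-≡)
open import Data.Integer as ℤ using (ℤ; +_; -[1+_]; -_; _◃_)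
import Data.Integer.Properties as ℤ
open import Data.Integer.Tactic.RingSolver using (solve-∀)
open import Data.List using (List; []; _∷_; map; concatMap; foldr; filter; length; cartesianProduct)
open import Data.List.Properties using (length-map; filter-≐)
open import Data.List.Membership.Propositional using (_∈_)
open import Data.List.Membership.Propositional.Properties
  using (∈-map⁺; ∈-map⁻; ∈-filter⁺; ∈-filter⁻; ∈-cartesianProduct⁺)
open import Data.List.Membership.Propositional.Properties.WithK using (unique∧set⇒bag)
import Data.List.Membership.DecPropositional as DecMembership
open import Data.List.Relation.Binary.BagAndSetEquality using (∼bag⇒↭)
open import Data.List.Relation.Binary.Permutation.Propositional.Properties using (↭-length)
open import Data.List.Relation.Unary.All as All using (All; []; _∷_; all?)
import Data.List.Relation.Unary.All.Properties as All
open import Data.List.Relation.Unary.AllPairs using ([]; _∷_)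
open import Data.List.Relation.Unary.Any as Any using (Any; here; there; any?)
import Data.List.Relation.Unary.Any.Properties as Any
open import Data.List.Relation.Unary.Unique.Propositional using (Unique)
import Data.List.Relation.Unary.Unique.Propositional.Properties as Unique
open import Data.Maybe as Maybe using (Maybe; just; nothing)
import Data.Maybe.Properties as Maybe
open import Data.Nat as ℕ using (zero; suc; ⌊_/2⌋; parity; _≡ᵇ_)
import Data.Nat.Properties as ℕ
open import Data.Nat.ListAction using (sum)
open import Data.Parity.Base as ℙ using (Parity; 0ℙ; 1ℙ; toSign)
import Data.Parity.Properties as ℙ
open import Data.Product using (∃₂; _,_; proj₁; proj₂)
import Data.Product.Properties as Product
open import Data.Sum using (_⊎_; inj₁; inj₂)
open import Function using (_∘_; _⇔_; mk⇔; Equivalence)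
open import Function.Construct.Composition using (_⇔-∘_)
open import Function.Construct.Symmetry using (⇔-sym)
open import Function.Related.Propositional using (module EquationalReasoning; equivalence)
open import Relation.Binary.Definitions using (DecidableEquality)
open import Relation.Binary.PropositionalEquality
  using (_≡_; refl; sym; trans; cong; cong₂; subst; subst₂; module ≡-Reasoning)
open import Relation.Nullary using (¬_; Dec; yes; no; ¬?)
open import Relation.Nullary.Decidable using (toWitness; _×-dec_; _⊎-dec_; _→-dec_)

infixl 6 _⊖_

_⊖_ : Pt → Pt → Pt
(x , y) ⊖ (x′ , y′) = (x ℤ.- x′ , y ℤ.- y′)

_≟ᴾ_ : DecidableEquality Pt
_≟ᴾ_ = Product.≡-dec ℤ._≟_ ℤ._≟_

open DecMembership _≟ᴾ_ using () renaming (_∈?_ to _∈ᴾ?_)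

⊕-assoc : ∀ u v w → (u ⊕ v) ⊕ w ≡ u ⊕ (v ⊕ w)
⊕-assoc (u₁ , u₂) (v₁ , v₂) (w₁ , w₂) = cong₂ _,_ (ℤ.+-assoc u₁ v₁ w₁) (ℤ.+-assoc u₂ v₂ w₂)

⊕-identityʳ : ∀ u → u ⊕ (+ 0 , + 0) ≡ u
⊕-identityʳ (u₁ , u₂) = cong₂ _,_ (ℤ.+-identityʳ u₁) (ℤ.+-identityʳ u₂)

⊕-⊖-cancel : ∀ u v → (u ⊕ v) ⊖ v ≡ u
⊕-⊖-cancel (u₁ , u₂) (v₁ , v₂) = cong₂ _,_ (ring u₁ v₁) (ring u₂ v₂)
  where ring : ∀ u v → (u ℤ.+ v) ℤ.- v ≡ u
        ring = solve-∀

⊖-⊕-cancel : ∀ u v → (u ⊖ v) ⊕ v ≡ u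
⊖-⊕-cancel (u₁ , u₂) (v₁ , v₂) = cong₂ _,_ (ring u₁ v₁) (ring u₂ v₂)
  where ring : ∀ u v → (u ℤ.- v) ℤ.+ v ≡ u
        ring = solve-∀

⊕-cancelˡ : ∀ u {v w} → u ⊕ v ≡ u ⊕ w → v ≡ w
⊕-cancelˡ u {v} {w} eq = trans (sym (⊕-⊖-left u v)) (trans (cong (_⊖ u) eq) (⊕-⊖-left u w))
  where
  ⊕-⊖-left : ∀ u v → (u ⊕ v) ⊖ u ≡ v
  ⊕-⊖-left (u₁ , u₂) (v₁ , v₂) = cong₂ _,_ (ring u₁ v₁) (ring u₂ v₂)
    where ring : ∀ u v → (u ℤ.+ v) ℤ.- u ≡ v
          ring = solve-∀

⊕-⊖-comm : ∀ u v w → (u ⊕ v) ⊖ w ≡ (u ⊖ w) ⊕ v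
⊕-⊖-comm (u₁ , u₂) (v₁ , v₂) (w₁ , w₂) = cong₂ _,_ (ring u₁ v₁ w₁) (ring u₂ v₂ w₂)
  where ring : ∀ u v w → (u ℤ.+ v) ℤ.- w ≡ (u ℤ.- w) ℤ.+ v
        ring = solve-∀

⊕-⊕-⊖-cancel : ∀ u v w → ((u ⊕ v) ⊕ w) ⊖ v ≡ u ⊕ w
⊕-⊕-⊖-cancel (u₁ , u₂) (v₁ , v₂) (w₁ , w₂) = cong₂ _,_ (ring u₁ v₁ w₁) (ring u₂ v₂ w₂)
  where ring : ∀ u v w → ((u ℤ.+ v) ℤ.+ w) ℤ.- v ≡ u ℤ.+ w
        ring = solve-∀

⊕-⊖-rebase : ∀ u o o₀ w → (u ⊕ o) ⊖ w ≡ (o ⊖ o₀) ⊕ ((u ⊕ o₀) ⊖ w)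
⊕-⊖-rebase (u₁ , u₂) (o₁ , o₂) (p₁ , p₂) (w₁ , w₂) = cong₂ _,_ (ring u₁ o₁ p₁ w₁) (ring u₂ o₂ p₂ w₂)
  where ring : ∀ u o p w → (u ℤ.+ o) ℤ.- w ≡ (o ℤ.- p) ℤ.+ ((u ℤ.+ p) ℤ.- w)
        ring = solve-∀

⊕≡⇔≡⊖ : ∀ {p d q} → (p ⊕ d ≡ q) ⇔ (p ≡ q ⊖ d)
⊕≡⇔≡⊖ {p} {d} = mk⇔ (λ { refl → sym (⊕-⊖-cancel p d) }) (λ { refl → ⊖-⊕-cancel _ d })

⊕-dbl-⊕ : ∀ v z w → v ⊕ dbl (z ⊕ w) ≡ (v ⊕ dbl z) ⊕ dbl w
⊕-dbl-⊕ (v₁ , v₂) (z₁ , z₂) (w₁ , w₂) = cong₂ _,_ (ring v₁ z₁ w₁) (ring v₂ z₂ w₂)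
  where ring : ∀ v z w → v ℤ.+ + 2 ℤ.* (z ℤ.+ w) ≡ (v ℤ.+ + 2 ℤ.* z) ℤ.+ + 2 ℤ.* w
        ring = solve-∀

cellCode-⊕ : ∀ c o → cellCode (c ⊕ o) ≡ cellCode c ⊕ dbl o
cellCode-⊕ (c₁ , c₂) (o₁ , o₂) = cong₂ _,_ (ring c₁ o₁) (ring c₂ o₂)
  where ring : ∀ c o → + 2 ℤ.* (c ℤ.+ o) ℤ.+ + 1 ≡ (+ 2 ℤ.* c ℤ.+ + 1) ℤ.+ + 2 ℤ.* o
        ring = solve-∀

cellCode-⊖ : ∀ c o → cellCode (c ⊖ o) ≡ cellCode c ⊖ dbl o
cellCode-⊖ (c₁ , c₂) (o₁ , o₂) = cong₂ _,_ (ring c₁ o₁) (ring c₂ o₂)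
  where ring : ∀ c o → + 2 ℤ.* (c ℤ.- o) ℤ.+ + 1 ≡ (+ 2 ℤ.* c ℤ.+ + 1) ℤ.- + 2 ℤ.* o
        ring = solve-∀

cellCode-injective : ∀ {c c′} → cellCode c ≡ cellCode c′ → c ≡ c′
cellCode-injective eq = cong₂ _,_ (odd-injective (cong proj₁ eq)) (odd-injective (cong proj₂ eq))
  where
  pred-odd : ∀ x → (+ 2 ℤ.* x ℤ.+ + 1) ℤ.- + 1 ≡ + 2 ℤ.* x
  pred-odd = solve-∀
  odd-injective : ∀ {x y} → + 2 ℤ.* x ℤ.+ + 1 ≡ + 2 ℤ.* y ℤ.+ + 1 → x ≡ y
  odd-injective {x} {y} eq =
    ℤ.*-cancelˡ-≡ (+ 2) x y (trans (sym (pred-odd x)) (trans (cong (ℤ._- + 1) eq) (pred-odd y)))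

-- ℤ./ℕ rounds down, so decode inverts cellCode on codes of cells.
decode : Pt → Pt
decode (x , y) = (x ℤ./ℕ 2 , y ℤ./ℕ 2)

∈-map-⊕⇔ : ∀ {x d xs} → x ∈ map (_⊕ d) xs ⇔ (x ⊖ d) ∈ xs
∈-map-⊕⇔ {x} {d} = mk⇔
  (λ x∈ → let y , y∈ , x≡ = ∈-map⁻ (_⊕ d) x∈ in
          subst (_∈ _) (trans (sym (⊕-⊖-cancel y d)) (cong (_⊖ d) (sym x≡))) y∈)
  (λ x⊖d∈ → subst (_∈ _) (⊖-⊕-cancel x d) (∈-map⁺ (_⊕ d) x⊖d∈))

data Direction : Set where
  east west north south : Direction

directions : List Direction
directions = east ∷ west ∷ north ∷ south ∷ []

∈-directions : ∀ e → e ∈ directions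
∈-directions east  = here refl
∈-directions west  = there (here refl)
∈-directions north = there (there (here refl))
∈-directions south = there (there (there (here refl)))

directions-unique : Unique directions
directions-unique = ((λ ()) ∷ (λ ()) ∷ (λ ()) ∷ []) ∷ ((λ ()) ∷ (λ ()) ∷ []) ∷ ((λ ()) ∷ []) ∷ [] ∷ []

unit : Direction → Pt
unit east  = (+ 1 , + 0)
unit west  = (- + 1 , + 0)
unit north = (+ 0 , + 1)
unit south = (+ 0 , - + 1)

reverse : Direction → Direction
reverse east  = west
reverse west  = east
reverse north = south
reverse south = north

unit-injective : ∀ {e f} → unit e ≡ unit f → e ≡ f
unit-injective {east}  {east}  _ = refl
unit-injective {west}  {west}  _ = refl
unit-injective {north} {north} _ = refl
unit-injective {south} {south} _ = refl
unit-injective {east}  {west}  ()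
unit-injective {east}  {north} ()
unit-injective {east}  {south} ()
unit-injective {west}  {east}  ()
unit-injective {west}  {north} ()
unit-injective {west}  {south} ()
unit-injective {north} {east}  ()
unit-injective {north} {west}  ()
unit-injective {north} {south} ()
unit-injective {south} {east}  ()
unit-injective {south} {west}  ()
unit-injective {south} {north} ()

⊕-unit-reverse : ∀ u e → (u ⊕ unit e) ⊕ unit (reverse e) ≡ u
⊕-unit-reverse u e = trans (⊕-assoc u (unit e) (unit (reverse e))) (trans (cong (u ⊕_) (cancels e)) (⊕-identityʳ u))
  where
  cancels : ∀ e → unit e ⊕ unit (reverse e) ≡ (+ 0 , + 0)
  cancels east  = refl
  cancels west  = refl
  cancels north = refl
  cancels south = refl

unitApart : ∀ u e → UnitApart u (u ⊕ unit e)
unitApart u east  = inj₁ refl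
unitApart u west  = inj₂ (inj₁ refl)
unitApart u north = inj₂ (inj₂ (inj₁ refl))
unitApart u south = inj₂ (inj₂ (inj₂ refl))

unitApart⇒unit : ∀ {u v} → UnitApart u v → ∃[ e ] v ≡ u ⊕ unit e
unitApart⇒unit (inj₁ v≡)               = east , v≡
unitApart⇒unit (inj₂ (inj₁ v≡))        = west , v≡
unitApart⇒unit (inj₂ (inj₂ (inj₁ v≡))) = north , v≡
unitApart⇒unit (inj₂ (inj₂ (inj₂ v≡))) = south , v≡

unitApart-sym : ∀ {u v} → UnitApart u v → UnitApart v u
unitApart-sym {u} apart with unitApart⇒unit {u} apart
... | e , refl = subst (UnitApart (u ⊕ unit e)) (⊕-unit-reverse u e) (unitApart (u ⊕ unit e) (reverse e))

unitVector : ∀ x y → x ℤ.* x ℤ.+ y ℤ.* y ≡ + 1 → ∃[ e ] (x , y) ≡ unit e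
unitVector (+ 0)           (+ 1)           _  = north , refl
unitVector (+ 0)           -[1+ 0 ]        _  = south , refl
unitVector (+ 1)           (+ 0)           _  = east , refl
unitVector -[1+ 0 ]        (+ 0)           _  = west , refl
unitVector (+ 0)           (+ 0)           ()
unitVector (+ 0)           (+ suc (suc _)) ()
unitVector (+ 0)           -[1+ suc _ ]    ()
unitVector (+ 1)           (+ suc _)       ()
unitVector (+ 1)           -[1+ _ ]        ()
unitVector -[1+ 0 ]        (+ suc _)       ()
unitVector -[1+ 0 ]        -[1+ _ ]        ()
unitVector (+ suc (suc _)) (+ 0)           ()
unitVector (+ suc (suc _)) (+ suc _)       ()
unitVector (+ suc (suc _)) -[1+ _ ]        ()
unitVector -[1+ suc _ ]    (+ 0)           ()
unitVector -[1+ suc _ ]    (+ suc _)       ()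
unitVector -[1+ suc _ ]    -[1+ _ ]        ()

columns : Direction → Direction → Mat
columns e f = mat (proj₁ (unit e)) (proj₁ (unit f)) (proj₂ (unit e)) (proj₂ (unit f))

Perpendicular : Direction → Direction → Set
Perpendicular e f = proj₁ (unit e) ℤ.* proj₁ (unit f) ℤ.+ proj₂ (unit e) ℤ.* proj₂ (unit f) ≡ + 0

orthogonal⇒columns : ∀ M → Orthogonal M → ∃₂ λ e f → M ≡ columns e f × Perpendicular e f
orthogonal⇒columns (mat m₁ m₂ m₃ m₄) (norm₁ , norm₂ , perpendicular)
  with unitVector m₁ m₃ norm₁ | unitVector m₂ m₄ norm₂
... | e , column₁≡ | f , column₂≡ =
  e , f , cong₂ (λ (m₁ , m₃) (m₂ , m₄) → mat m₁ m₂ m₃ m₄) column₁≡ column₂≡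
        , subst₂ (λ (m₁ , m₃) (m₂ , m₄) → m₁ ℤ.* m₂ ℤ.+ m₃ ℤ.* m₄ ≡ + 0) column₁≡ column₂≡ perpendicular

data Side : Set where
  rightSide topSide : Side

step : Side → Pt
step rightSide = (+ 1 , + 0)
step topSide   = (+ 0 , + 1)

sideOf : Direction → Side
sideOf east  = topSide
sideOf west  = topSide
sideOf north = rightSide
sideOf south = rightSide

-- The unit segment from u in direction e is the (sideOf e)-side of the cell with lower-left corner
-- u ⊕ flank e; the cell on its other side has lower-left corner u ⊕ opposite e.
flank : Direction → Pt
flank east  = (+ 0 , - + 1)
flank west  = (- + 1 , - + 1)
flank north = (- + 1 , + 0)
flank south = (- + 1 , - + 1)

opposite : Direction → Pt
opposite e = flank e ⊕ step (sideOf e)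

Inside : Tile → Pt → Set
Inside t c = cellCode c ∈ cells t

Joins : Pt → Pt → Pt × Pt → Set
Joins u v s = (proj₁ s ≡ u × proj₂ s ≡ v) ⊎ (proj₁ s ≡ v × proj₂ s ≡ u)

joins? : ∀ u v s → Dec (Joins u v s)
joins? u v (p , q) = ((p ≟ᴾ u) ×-dec (q ≟ᴾ v)) ⊎-dec ((p ≟ᴾ v) ×-dec (q ≟ᴾ u))

joins-sym : ∀ {u v s} → Joins u v s → Joins v u s
joins-sym (inj₁ p) = inj₂ p
joins-sym (inj₂ p) = inj₁ p

OnBoundary : Tile → Pt → Pt → Set
OnBoundary t u v = Any (Joins u v) (boundarySegs t)

G₁-sym : ∀ {T u v} → G₁ T u v → G₁ T v u
G₁-sym (apart , t , t∈T , onBoundary) = unitApart-sym apart , t , t∈T , Any.map joins-sym onBoundary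

ExactlyOne : Set → Set → Set
ExactlyOne A B = (A × ¬ B) ⊎ (¬ A × B)

exactlyOne-cong : ∀ {A A′ B B′} → A ⇔ A′ → B ⇔ B′ → ExactlyOne A′ B′ → ExactlyOne A B
exactlyOne-cong A⇔ B⇔ (inj₁ (a , ¬b)) = inj₁ (Equivalence.from A⇔ a , ¬b ∘ Equivalence.to B⇔)
exactlyOne-cong A⇔ B⇔ (inj₂ (¬a , b)) = inj₂ (¬a ∘ Equivalence.to A⇔ , Equivalence.from B⇔ b)

shapeCells : Mat → List Pt
shapeCells M = map (M ·_) L₀cells

shapeSegs : Mat → List (Pt × Pt)
shapeSegs M = map (λ s → (M · proj₁ s , M · proj₂ s)) L₀boundary

InShape : Mat → Pt → Set
InShape M c = cellCode c ∈ shapeCells M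

inside-tile : ∀ M b u o → Inside (tile M b) (u ⊕ o) ⇔ InShape M ((u ⊖ b) ⊕ o)
inside-tile M b u o = subst (λ v → Inside (tile M b) (u ⊕ o) ⇔ InShape M v) (⊕-⊖-comm u o b) (mk⇔
  (λ c∈ → subst (_∈ _) (sym (cellCode-⊖ (u ⊕ o) b)) (Equivalence.to ∈-map-⊕⇔ c∈))
  (λ c∈ → Equivalence.from ∈-map-⊕⇔ (subst (_∈ _) (cellCode-⊖ (u ⊕ o) b) c∈)))

translateSeg : Pt → Pt × Pt → Pt × Pt
translateSeg d (p , q) = (p ⊕ d , q ⊕ d)

joins-translate : ∀ {u v d} s → Joins u v (translateSeg d s) ⇔ Joins (u ⊖ d) (v ⊖ d) s
joins-translate {u} {v} {d} (p , q) = mk⇔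
  (λ { (inj₁ (p≡ , q≡)) → inj₁ (to p≡ , to q≡) ; (inj₂ (p≡ , q≡)) → inj₂ (to p≡ , to q≡) })
  (λ { (inj₁ (p≡ , q≡)) → inj₁ (from p≡ , from q≡) ; (inj₂ (p≡ , q≡)) → inj₂ (from p≡ , from q≡) })
  where
  to : ∀ {p w} → p ⊕ d ≡ w → p ≡ w ⊖ d
  to = Equivalence.to ⊕≡⇔≡⊖
  from : ∀ {p w} → p ≡ w ⊖ d → p ⊕ d ≡ w
  from = Equivalence.from ⊕≡⇔≡⊖

module Shape (M : Mat) (e : Direction) where

  OnShapeBoundary : Pt → Set
  OnShapeBoundary u = Any (Joins u (u ⊕ unit e)) (shapeSegs M)

  Separates : Pt → Set
  Separates u = ExactlyOne (InShape M (u ⊕ flank e)) (InShape M (u ⊕ opposite e))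

  inShape? : ∀ c → Dec (InShape M c)
  inShape? c = cellCode c ∈ᴾ? shapeCells M

  separates? : ∀ u → Dec (Separates u)
  separates? u = (inShape? near ×-dec ¬? (inShape? far)) ⊎-dec (¬? (inShape? near) ×-dec inShape? far)
    where near = u ⊕ flank e
          far  = u ⊕ opposite e

  -- A vertex on the boundary is an endpoint of one of the eight segments of the shape, and a
  -- cell inside is one of its three cells: both halves of the boundary criterion are finite checks.
  SegmentsSeparate : Set
  SegmentsSeparate = All (λ (p , q) → (q ≡ p ⊕ unit e → Separates p) × (p ≡ q ⊕ unit e → Separates q)) (shapeSegs M)

  CellsBounded : Set
  CellsBounded = All (λ k → let u = decode k ⊖ flank e in
                            cellCode (decode k) ≡ k × (¬ InShape M (u ⊕ opposite e) → OnShapeBoundary u))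
                     (shapeCells M)

  Criterion : Set
  Criterion = SegmentsSeparate × CellsBounded

  criterion? : Dec Criterion
  criterion? =
    all? (λ (p , q) → ((q ≟ᴾ (p ⊕ unit e)) →-dec separates? p) ×-dec ((p ≟ᴾ (q ⊕ unit e)) →-dec separates? q))
         (shapeSegs M)
    ×-dec
    all? (λ k → let u = decode k ⊖ flank e in
                (cellCode (decode k) ≟ᴾ k) ×-dec (¬? (inShape? (u ⊕ opposite e)) →-dec any? (joins? u (u ⊕ unit e)) (shapeSegs M)))
         (shapeCells M)

  boundary⇒separates : SegmentsSeparate → ∀ {u} → OnShapeBoundary u → Separates u
  boundary⇒separates checks on with All.lookupAny checks on
  ... | (separates , _) , inj₁ (p≡u , q≡) = subst Separates p≡u (separates (trans q≡ (cong (_⊕ unit e) (sym p≡u))))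
  ... | (_ , separates) , inj₂ (p≡ , q≡u) = subst Separates q≡u (separates (trans p≡ (cong (_⊕ unit e) (sym q≡u))))

  inside⇒boundary : CellsBounded → ∀ {u} → InShape M (u ⊕ flank e) → ¬ InShape M (u ⊕ opposite e) → OnShapeBoundary u
  inside⇒boundary checks {u} inside outside with All.lookupAny checks inside
  ... | (decoded , bounded) , code≡ =
    subst OnShapeBoundary u≡ (bounded (outside ∘ subst (λ v → InShape M (v ⊕ opposite e)) u≡))
    where
    u≡ : decode (Any.lookup inside) ⊖ flank e ≡ u
    u≡ = sym (Equivalence.to (⊕≡⇔≡⊖ {u} {flank e} {decode (Any.lookup inside)})
                             (cellCode-injective (trans code≡ (sym decoded))))

  onBoundary-tile : ∀ b u → OnBoundary (tile M b) u (u ⊕ unit e) ⇔ OnShapeBoundary (u ⊖ b)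
  onBoundary-tile b u =
    subst (λ v → OnBoundary (tile M b) u (u ⊕ unit e) ⇔ Any (Joins (u ⊖ b) v) (shapeSegs M)) (⊕-⊖-comm u (unit e) b) (mk⇔
      (Any.map (λ {s} → Equivalence.to (joins-translate s)) ∘ Any.map⁻ {f = translateSeg b})
      (Any.map⁺ {f = translateSeg b} ∘ Any.map (λ {s} → Equivalence.from (joins-translate s))))

shapeCriterion : ∀ e₁ e₂ e → Perpendicular e₁ e₂ → Shape.Criterion (columns e₁ e₂) e
shapeCriterion e₁ e₂ e = All.lookup (All.lookup (All.lookup checked (∈-directions e₁)) (∈-directions e₂)) (∈-directions e)
  where
  checked : All (λ e₁ → All (λ e₂ → All (λ e → Perpendicular e₁ e₂ → Shape.Criterion (columns e₁ e₂) e)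
                                        directions) directions) directions
  checked = toWitness {a? = all? (λ e₁ → all? (λ e₂ → all? (λ e →
                              (proj₁ (unit e₁) ℤ.* proj₁ (unit e₂) ℤ.+ proj₂ (unit e₁) ℤ.* proj₂ (unit e₂) ℤ.≟ + 0)
                              →-dec Shape.criterion? (columns e₁ e₂) e) directions) directions) directions} _

boundary⇒exactlyOne : ∀ t → Orthogonal (Q t) → ∀ {u e} → OnBoundary t u (u ⊕ unit e) →
                      ExactlyOne (Inside t (u ⊕ flank e)) (Inside t (u ⊕ opposite e))
boundary⇒exactlyOne (tile M b) orthogonal {u} {e} onBoundary with orthogonal⇒columns M orthogonal
... | e₁ , e₂ , refl , perpendicular =
  exactlyOne-cong (inside-tile M b u (flank e)) (inside-tile M b u (opposite e))
    (Shape.boundary⇒separates M e (proj₁ (shapeCriterion e₁ e₂ e perpendicular))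
      (Equivalence.to (Shape.onBoundary-tile M e b u) onBoundary))

insideOutside⇒boundary : ∀ t → Orthogonal (Q t) → ∀ {u e} → Inside t (u ⊕ flank e) → ¬ Inside t (u ⊕ opposite e) →
                         OnBoundary t u (u ⊕ unit e)
insideOutside⇒boundary (tile M b) orthogonal {u} {e} inside outside with orthogonal⇒columns M orthogonal
... | e₁ , e₂ , refl , perpendicular =
  Equivalence.from (Shape.onBoundary-tile M e b u)
    (Shape.inside⇒boundary M e (proj₂ (shapeCriterion e₁ e₂ e perpendicular))
      (Equivalence.to (inside-tile M b u (flank e)) inside)
      (outside ∘ Equivalence.from (inside-tile M b u (opposite e))))

degree-functional : ∀ {E u k m} → Degree E u k → Degree E u m → k ≡ m
degree-functional (ns , (ns-unique , ns⇔) , refl) (ms , (ms-unique , ms⇔) , refl) =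
  ↭-length (∼bag⇒↭ (unique∧set⇒bag ns-unique ms-unique λ {v} → ms⇔ v ⇔-∘ ⇔-sym (ns⇔ v)))

module Tiling {𝒯 : Tile → Set} (tiling : ChairTiling 𝒯) where
  open ChairTiling tiling

  tileOf : Pt → Tile
  tileOf c = proj₁ (covers c)

  tileOf∈𝒯 : ∀ c → 𝒯 (tileOf c)
  tileOf∈𝒯 c = proj₁ (proj₂ (covers c))

  inside-tileOf : ∀ c → Inside (tileOf c) c
  inside-tileOf c = proj₂ (proj₂ (covers c))

  shared⇒inside : ∀ {t t′} → 𝒯 t → 𝒯 t′ → ∀ c → Inside t c → Inside t′ c → ∀ c′ → Inside t c′ → Inside t′ c′
  shared⇒inside {t} {t′} t∈𝒯 t′∈𝒯 c c∈t c∈t′ c′ = Equivalence.to (disjoint t t′ t∈𝒯 t′∈𝒯 (cellCode c) c∈t c∈t′ (cellCode c′))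

  Crosses : Pt → Direction → Set
  Crosses u e = ¬ Inside (tileOf (u ⊕ flank e)) (u ⊕ opposite e)

  crosses? : ∀ u e → Dec (Crosses u e)
  crosses? u e = ¬? (cellCode (u ⊕ opposite e) ∈ᴾ? cells (tileOf (u ⊕ flank e)))

  edge⇔crosses : ∀ u e → G₁ 𝒯 u (u ⊕ unit e) ⇔ Crosses u e
  edge⇔crosses u e = mk⇔ edge⇒crosses crosses⇒edge
    where
    near = u ⊕ flank e
    far  = u ⊕ opposite e
    edge⇒crosses : G₁ 𝒯 u (u ⊕ unit e) → Crosses u e
    edge⇒crosses (_ , t , t∈𝒯 , onBoundary) with boundary⇒exactlyOne t (isometric t t∈𝒯) {u} {e} onBoundary
    ... | inj₁ (near∈t , far∉t) = far∉t ∘ shared⇒inside (tileOf∈𝒯 near) t∈𝒯 near (inside-tileOf near) near∈t far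
    ... | inj₂ (near∉t , far∈t) = λ far∈ → near∉t (shared⇒inside (tileOf∈𝒯 near) t∈𝒯 far far∈ far∈t near (inside-tileOf near))
    crosses⇒edge : Crosses u e → G₁ 𝒯 u (u ⊕ unit e)
    crosses⇒edge crosses =
      unitApart u e , tileOf near , tileOf∈𝒯 near ,
      insideOutside⇒boundary (tileOf near) (isometric _ (tileOf∈𝒯 near)) {u} {e} (inside-tileOf near) crosses

  crossing : Pt → List Direction
  crossing u = filter (crosses? u) directions

  neighbours : Pt → List Pt
  neighbours u = map (λ e → u ⊕ unit e) (crossing u)

  degree : Pt → ℕ
  degree u = length (crossing u)

  neighbourList : ∀ u → NeighbourList (G₁ 𝒯) u (neighbours u)
  neighbourList u =
    Unique.map⁺ (unit-injective ∘ ⊕-cancelˡ u) (Unique.filter⁺ (crosses? u) directions-unique) ,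
    λ v → mk⇔ edge⇒∈ ∈⇒edge
    where
    edge⇒∈ : ∀ {v} → G₁ 𝒯 u v → v ∈ neighbours u
    edge⇒∈ edge with unitApart⇒unit {u} (proj₁ edge)
    ... | e , refl = ∈-map⁺ _ (∈-filter⁺ (crosses? u) (∈-directions e) (Equivalence.to (edge⇔crosses u e) edge))
    ∈⇒edge : ∀ {v} → v ∈ neighbours u → G₁ 𝒯 u v
    ∈⇒edge v∈ with ∈-map⁻ _ v∈
    ... | e , e∈ , refl = Equivalence.from (edge⇔crosses u e) (proj₂ (∈-filter⁻ (crosses? u) e∈))

  hasDegree : ∀ u → Degree (G₁ 𝒯) u (degree u)
  hasDegree u = neighbours u , neighbourList u , length-map _ (crossing u)

-- Cell types of σⁿ(L₀)

-- A tile of σⁿ(L₀) is L₀ reflected in the axes flagged by 1ℙ, then translated.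
Reflection : Set
Reflection = Parity × Parity

_∙_ : Reflection → Reflection → Reflection
(p , q) ∙ (p′ , q′) = (p ℙ.+ p′ , q ℙ.+ q′)

reflect : Reflection → Mat
reflect (p , q) = mat (toSign p ◃ 1) (+ 0) (+ 0) (toSign q ◃ 1)

sign-* : ∀ p p′ → (toSign p ◃ 1) ℤ.* (toSign p′ ◃ 1) ≡ toSign (p ℙ.+ p′) ◃ 1
sign-* 0ℙ 0ℙ = refl
sign-* 0ℙ 1ℙ = refl
sign-* 1ℙ 0ℙ = refl
sign-* 1ℙ 1ℙ = refl

reflect-∙ : ∀ r r′ → reflect r ∘M reflect r′ ≡ reflect (r ∙ r′)
reflect-∙ (p , q) (p′ , q′)
  rewrite ℤ.*-zeroʳ (toSign p ◃ 1) | ℤ.*-zeroʳ (toSign q ◃ 1)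
        | ℤ.+-identityʳ ((toSign p ◃ 1) ℤ.* (toSign p′ ◃ 1)) | ℤ.+-identityˡ ((toSign q ◃ 1) ℤ.* (toSign q′ ◃ 1))
        | sign-* p p′ | sign-* q q′ = refl

data Ix : Set where
  corner armˣ armʸ : Ix

_≟ᴵ_ : DecidableEquality Ix
corner ≟ᴵ corner = yes refl
corner ≟ᴵ armˣ   = no λ ()
corner ≟ᴵ armʸ   = no λ ()
armˣ   ≟ᴵ corner = no λ ()
armˣ   ≟ᴵ armˣ   = yes refl
armˣ   ≟ᴵ armʸ   = no λ ()
armʸ   ≟ᴵ corner = no λ ()
armʸ   ≟ᴵ armˣ   = no λ ()
armʸ   ≟ᴵ armʸ   = yes refl

ixs : List Ix
ixs = corner ∷ armˣ ∷ armʸ ∷ []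

∈-ixs : ∀ i → i ∈ ixs
∈-ixs corner = here refl
∈-ixs armˣ   = there (here refl)
∈-ixs armʸ   = there (there (here refl))

L₀cell : Ix → Pt
L₀cell corner = cellCode (+ 0 , + 0)
L₀cell armˣ   = cellCode (+ 1 , + 0)
L₀cell armʸ   = cellCode (+ 0 , + 1)

cellOf : Tile → Ix → Pt
cellOf t i = (Q t · L₀cell i) ⊕ dbl (b t)

inside⇔cellOf : ∀ t c → Inside t c ⇔ (∃[ i ] cellCode c ≡ cellOf t i)
inside⇔cellOf t c = mk⇔ index member
  where
  index : Inside t c → ∃[ i ] cellCode c ≡ cellOf t i
  index (here eq)                 = corner , eq
  index (there (here eq))         = armˣ , eq
  index (there (there (here eq))) = armʸ , eq
  member : ∃[ i ] cellCode c ≡ cellOf t i → Inside t c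
  member (corner , eq) = here eq
  member (armˣ , eq)   = there (here eq)
  member (armʸ , eq)   = there (there (here eq))

CellType : Set
CellType = Reflection × Ix

joined : Side → CellType → Bool
joined rightSide ((0ℙ , _) , corner) = true
joined rightSide ((1ℙ , _) , armˣ)   = true
joined topSide   ((_ , 0ℙ) , corner) = true
joined topSide   ((_ , 1ℙ) , armʸ)   = true
joined _         _                   = false

parities : List Parity
parities = 0ℙ ∷ 1ℙ ∷ []

∈-parities : ∀ p → p ∈ parities
∈-parities 0ℙ = here refl
∈-parities 1ℙ = there (here refl)

sides : List Side
sides = rightSide ∷ topSide ∷ []

∈-sides : ∀ s → s ∈ sides
∈-sides rightSide = here refl
∈-sides topSide   = there (here refl)

SameTileAcross : Reflection → Ix → Side → Set
SameTileAcross r i s = ((reflect r · L₀cell i) ⊕ dbl (step s)) ∈ shapeCells (reflect r)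

joined-correct : ∀ r i s → SameTileAcross r i s ⇔ T (joined s (r , i))
joined-correct (p , q) i s = mk⇔ (proj₁ check) (proj₂ check)
  where
  checked : All (λ r → All (λ i → All (λ s → (SameTileAcross r i s → T (joined s (r , i)))
                                            × (T (joined s (r , i)) → SameTileAcross r i s)) sides) ixs)
                (cartesianProduct parities parities)
  checked = toWitness {a? = all? (λ r → all? (λ i → all? (λ s → (_ ∈ᴾ? _ →-dec T? _) ×-dec (T? _ →-dec _ ∈ᴾ? _)) sides) ixs)
                                 (cartesianProduct parities parities)} _
  check = All.lookup (All.lookup (All.lookup checked (∈-cartesianProduct⁺ (∈-parities p) (∈-parities q))) (∈-ixs i)) (∈-sides s)

-- σ-cell i p q is the type, relative to the parent tile, of the child of the cell i of L₀ whose
-- coordinates have parities p and q, read off from σ(L₀) = {L₀, L₀ + (1,1), A, B}.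
σ-cell : Ix → Parity → Parity → CellType
σ-cell corner 0ℙ 0ℙ = (0ℙ , 0ℙ) , corner
σ-cell corner 1ℙ 0ℙ = (0ℙ , 0ℙ) , armˣ
σ-cell corner 0ℙ 1ℙ = (0ℙ , 0ℙ) , armʸ
σ-cell corner 1ℙ 1ℙ = (0ℙ , 0ℙ) , corner
σ-cell armˣ   0ℙ 0ℙ = (1ℙ , 0ℙ) , armˣ
σ-cell armˣ   1ℙ 0ℙ = (1ℙ , 0ℙ) , corner
σ-cell armˣ   0ℙ 1ℙ = (0ℙ , 0ℙ) , armˣ
σ-cell armˣ   1ℙ 1ℙ = (1ℙ , 0ℙ) , armʸ
σ-cell armʸ   0ℙ 0ℙ = (0ℙ , 1ℙ) , armʸ
σ-cell armʸ   1ℙ 0ℙ = (0ℙ , 0ℙ) , armʸ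
σ-cell armʸ   0ℙ 1ℙ = (0ℙ , 1ℙ) , corner
σ-cell armʸ   1ℙ 1ℙ = (0ℙ , 1ℙ) , armˣ

-- Adding the parent's reflection turns the parities of the child's coordinates into parities in
-- the parent tile's own frame.
childType : CellType → Parity → Parity → CellType
childType (r , i) p q = r ∙ proj₁ child , proj₂ child
  where child = σ-cell i (p ℙ.+ proj₁ r) (q ℙ.+ proj₂ r)

-- nothing marks the cells that σⁿ(L₀) does not cover.
typeAt : ℕ → ℕ → ℕ → Maybe CellType
typeAt zero    0 0 = just ((0ℙ , 0ℙ) , corner)
typeAt zero    1 0 = just ((0ℙ , 0ℙ) , armˣ)
typeAt zero    0 1 = just ((0ℙ , 0ℙ) , armʸ)
typeAt zero    _ _ = nothing
typeAt (suc n) x y = Maybe.map (λ κ → childType κ (parity x) (parity y)) (typeAt n ⌊ x /2⌋ ⌊ y /2⌋)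

bit : Parity → ℕ
bit 0ℙ = 0
bit 1ℙ = 1

infixl 7 _·2+_

_·2+_ : ℕ → Parity → ℕ
zero  ·2+ p = bit p
suc x ·2+ p = suc (suc (x ·2+ p))

⌊·2+/2⌋ : ∀ x p → ⌊ x ·2+ p /2⌋ ≡ x
⌊·2+/2⌋ zero    0ℙ = refl
⌊·2+/2⌋ zero    1ℙ = refl
⌊·2+/2⌋ (suc x) p  = cong suc (⌊·2+/2⌋ x p)

parity-·2+ : ∀ x p → parity (x ·2+ p) ≡ p
parity-·2+ zero    0ℙ = refl
parity-·2+ zero    1ℙ = refl
parity-·2+ (suc x) p  = parity-·2+ x p

+-·2+ : ∀ x p → + (x ·2+ p) ≡ + 2 ℤ.* + x ℤ.+ + bit p
+-·2+ zero    p = refl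
+-·2+ (suc x) p = trans (cong (λ z → + 2 ℤ.+ z) (+-·2+ x p)) (ring (+ x) (+ bit p))
  where ring : ∀ x b → + 2 ℤ.+ (+ 2 ℤ.* x ℤ.+ b) ≡ + 2 ℤ.* (+ 1 ℤ.+ x) ℤ.+ b
        ring = solve-∀

typeAt-·2+ : ∀ n x y p q → typeAt (suc n) (x ·2+ p) (y ·2+ q) ≡ Maybe.map (λ κ → childType κ p q) (typeAt n x y)
typeAt-·2+ n x y p q rewrite ⌊·2+/2⌋ x p | ⌊·2+/2⌋ y q | parity-·2+ x p | parity-·2+ y q = refl

+-cancel-twice : ∀ p f → p ℙ.+ f ℙ.+ f ≡ p
+-cancel-twice 0ℙ 0ℙ = refl
+-cancel-twice 0ℙ 1ℙ = refl
+-cancel-twice 1ℙ 0ℙ = refl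
+-cancel-twice 1ℙ 1ℙ = refl

childType-σ-cell : ∀ {r i p q r′ k} → σ-cell i p q ≡ (r′ , k) → childType (r , i) (p ℙ.+ proj₁ r) (q ℙ.+ proj₂ r) ≡ (r ∙ r′ , k)
childType-σ-cell {r} {i} {p} {q} eq rewrite +-cancel-twice p (proj₁ r) | +-cancel-twice q (proj₂ r) | eq = refl

-- The code of a child cell is twice the code of its parent plus shift of its parities.
shift : Parity → ℤ
shift 0ℙ = -[1+ 0 ]
shift 1ℙ = + 1

sign-shift : ∀ f p → (toSign f ◃ 1) ℤ.* shift p ≡ shift (p ℙ.+ f)
sign-shift 0ℙ 0ℙ = refl
sign-shift 0ℙ 1ℙ = refl
sign-shift 1ℙ 0ℙ = refl
sign-shift 1ℙ 1ℙ = refl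

reflect-shift : ∀ r p q → reflect r · (shift p , shift q) ≡ (shift (p ℙ.+ proj₁ r) , shift (q ℙ.+ proj₂ r))
reflect-shift (f , g) p q = cong₂ _,_ (trans (ℤ.+-identityʳ _) (sign-shift f p)) (trans (ℤ.+-identityˡ _) (sign-shift g q))

dbl-cellCode-shift : ∀ x y p q → dbl (cellCode (+ x , + y)) ⊕ (shift p , shift q) ≡ cellCode (+ (x ·2+ p) , + (y ·2+ q))
dbl-cellCode-shift x y p q = cong₂ _,_ (component x p) (component y q)
  where
  ring : ∀ p z → + 2 ℤ.* (+ 2 ℤ.* z ℤ.+ + 1) ℤ.+ shift p ≡ + 2 ℤ.* (+ 2 ℤ.* z ℤ.+ + bit p) ℤ.+ + 1
  ring 0ℙ = solve-∀
  ring 1ℙ = solve-∀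
  component : ∀ x p → + 2 ℤ.* (+ 2 ℤ.* + x ℤ.+ + 1) ℤ.+ shift p ≡ + 2 ℤ.* + (x ·2+ p) ℤ.+ + 1
  component x p = trans (ring p (+ x)) (cong (λ z → + 2 ℤ.* z ℤ.+ + 1) (sym (+-·2+ x p)))


Placed : ℕ → Pt → CellType → Set
Placed n k κ = ∃[ x ] ∃[ y ] (k ≡ cellCode (+ x , + y) × typeAt n x y ≡ just κ)

Labelled : ℕ → Tile → Set
Labelled n t = ∃[ r ] (Q t ≡ reflect r × ∀ i → Placed n (cellOf t i) (r , i))

AgreesWithσ-cell : Tile → Set
AgreesWithσ-cell P = ∃[ r ] (Q P ≡ reflect r ×
  ∀ k → ∃[ i ] ∃[ p ] ∃[ q ] (cellOf P k ≡ dbl (L₀cell i) ⊕ (shift p , shift q) × σ-cell i p q ≡ (r , k)))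

σL₀-agrees : All AgreesWithσ-cell σL₀
σL₀-agrees =
    ((0ℙ , 0ℙ) , refl , λ { corner → corner , 0ℙ , 0ℙ , refl , refl
                          ; armˣ   → corner , 1ℙ , 0ℙ , refl , refl
                          ; armʸ   → corner , 0ℙ , 1ℙ , refl , refl })
  ∷ ((0ℙ , 0ℙ) , refl , λ { corner → corner , 1ℙ , 1ℙ , refl , refl
                          ; armˣ   → armˣ   , 0ℙ , 1ℙ , refl , refl
                          ; armʸ   → armʸ   , 1ℙ , 0ℙ , refl , refl })
  ∷ ((1ℙ , 0ℙ) , refl , λ { corner → armˣ   , 1ℙ , 0ℙ , refl , refl
                          ; armˣ   → armˣ   , 0ℙ , 0ℙ , refl , refl
                          ; armʸ   → armˣ   , 1ℙ , 1ℙ , refl , refl })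
  ∷ ((0ℙ , 1ℙ) , refl , λ { corner → armʸ   , 0ℙ , 1ℙ , refl , refl
                          ; armˣ   → armʸ   , 1ℙ , 1ℙ , refl , refl
                          ; armʸ   → armʸ   , 0ℙ , 0ℙ , refl , refl })
  ∷ []

child : Tile → Tile → Tile
child s P = tile (Q s ∘M Q P) ((Q s · b P) ⊕ dbl (b s))

cellOf-child : ∀ s P k → cellOf (child s P) k ≡ (Q s · cellOf P k) ⊕ dbl (dbl (b s))
cellOf-child (tile (mat m₁ m₂ m₃ m₄) (z₁ , z₂)) (tile (mat n₁ n₂ n₃ n₄) (w₁ , w₂)) k with L₀cell k
... | (v₁ , v₂) = cong₂ _,_ (ring m₁ m₂ n₁ n₂ n₃ n₄ v₁ v₂ w₁ w₂ z₁) (ring m₃ m₄ n₁ n₂ n₃ n₄ v₁ v₂ w₁ w₂ z₂)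
  where
  ring : ∀ m m′ n₁ n₂ n₃ n₄ v₁ v₂ w₁ w₂ z →
           (m ℤ.* n₁ ℤ.+ m′ ℤ.* n₃) ℤ.* v₁ ℤ.+ (m ℤ.* n₂ ℤ.+ m′ ℤ.* n₄) ℤ.* v₂
             ℤ.+ + 2 ℤ.* (m ℤ.* w₁ ℤ.+ m′ ℤ.* w₂ ℤ.+ + 2 ℤ.* z)
         ≡ m ℤ.* (n₁ ℤ.* v₁ ℤ.+ n₂ ℤ.* v₂ ℤ.+ + 2 ℤ.* w₁) ℤ.+ m′ ℤ.* (n₃ ℤ.* v₁ ℤ.+ n₄ ℤ.* v₂ ℤ.+ + 2 ℤ.* w₂)
             ℤ.+ + 2 ℤ.* (+ 2 ℤ.* z)
  ring = solve-∀

·-dbl-⊕ : ∀ M v o z → (M · (dbl v ⊕ o)) ⊕ dbl (dbl z) ≡ dbl ((M · v) ⊕ dbl z) ⊕ (M · o)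
·-dbl-⊕ (mat m₁ m₂ m₃ m₄) (v₁ , v₂) (o₁ , o₂) (z₁ , z₂) = cong₂ _,_ (ring m₁ m₂ v₁ v₂ o₁ o₂ z₁) (ring m₃ m₄ v₁ v₂ o₁ o₂ z₂)
  where
  ring : ∀ m m′ v₁ v₂ o₁ o₂ z → m ℤ.* (+ 2 ℤ.* v₁ ℤ.+ o₁) ℤ.+ m′ ℤ.* (+ 2 ℤ.* v₂ ℤ.+ o₂) ℤ.+ + 2 ℤ.* (+ 2 ℤ.* z)
                             ≡ + 2 ℤ.* (m ℤ.* v₁ ℤ.+ m′ ℤ.* v₂ ℤ.+ + 2 ℤ.* z) ℤ.+ (m ℤ.* o₁ ℤ.+ m′ ℤ.* o₂)
  ring = solve-∀

child-labelled : ∀ {n s P} → Labelled n s → AgreesWithσ-cell P → Labelled (suc n) (child s P)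
child-labelled {n} {s} {P} (r , Qs≡ , placed) (r′ , QP≡ , agrees) =
  r ∙ r′ , trans (cong₂ _∘M_ Qs≡ QP≡) (reflect-∙ r r′) , placedChild
  where
  placedChild : ∀ k → Placed (suc n) (cellOf (child s P) k) (r ∙ r′ , k)
  placedChild k with agrees k
  ... | i , p , q , cell≡ , σ-cell≡ with placed i
  ... | x , y , code≡ , type≡ = x ·2+ p′ , y ·2+ q′ , position , type
    where
    open ≡-Reasoning
    p′ = p ℙ.+ proj₁ r
    q′ = q ℙ.+ proj₂ r
    position : cellOf (child s P) k ≡ cellCode (+ (x ·2+ p′) , + (y ·2+ q′))
    position = begin
      cellOf (child s P) k                                              ≡⟨ cellOf-child s P k ⟩
      (Q s · cellOf P k) ⊕ dbl (dbl (b s))                              ≡⟨ cong (λ v → (Q s · v) ⊕ dbl (dbl (b s))) cell≡ ⟩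
      (Q s · (dbl (L₀cell i) ⊕ (shift p , shift q))) ⊕ dbl (dbl (b s)) ≡⟨ ·-dbl-⊕ (Q s) (L₀cell i) _ (b s) ⟩
      dbl (cellOf s i) ⊕ (Q s · (shift p , shift q))                    ≡⟨ cong₂ (λ v M → dbl v ⊕ (M · (shift p , shift q))) code≡ Qs≡ ⟩
      dbl (cellCode (+ x , + y)) ⊕ (reflect r · (shift p , shift q))   ≡⟨ cong (dbl (cellCode (+ x , + y)) ⊕_) (reflect-shift r p q) ⟩
      dbl (cellCode (+ x , + y)) ⊕ (shift p′ , shift q′)                ≡⟨ dbl-cellCode-shift x y p′ q′ ⟩
      cellCode (+ (x ·2+ p′) , + (y ·2+ q′))                            ∎
    type : typeAt (suc n) (x ·2+ p′) (y ·2+ q′) ≡ just (r ∙ r′ , k)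
    type = begin
      typeAt (suc n) (x ·2+ p′) (y ·2+ q′)                ≡⟨ typeAt-·2+ n x y p′ q′ ⟩
      Maybe.map (λ κ → childType κ p′ q′) (typeAt n x y) ≡⟨ cong (Maybe.map (λ κ → childType κ p′ q′)) type≡ ⟩
      just (childType (r , i) p′ q′)                      ≡⟨ cong just (childType-σ-cell σ-cell≡) ⟩
      just (r ∙ r′ , k)                                   ∎

σ-labelled : ∀ {n s} → Labelled n s → All (Labelled (suc n)) (σ s)
σ-labelled {n} labelled = All.map⁺ (All.map (child-labelled {n} labelled) σL₀-agrees)

σ^-labelled : ∀ n → All (Labelled n) (σ^ n)
σ^-labelled zero    = ((0ℙ , 0ℙ) , refl , λ { corner → 0 , 0 , refl , refl
                                              ; armˣ   → 1 , 0 , refl , refl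
                                              ; armʸ   → 0 , 1 , refl , refl }) ∷ []
σ^-labelled (suc n) = All.concat⁺ (All.map⁺ (All.map (σ-labelled {n}) (σ^-labelled n)))

-- Windows of cell types

-- The cells below-left, below-right and above-left of a vertex carry its four edges.
flankType : CellType → CellType → CellType → Direction → CellType
flankType ll lr ul east  = lr
flankType ll lr ul west  = ll
flankType ll lr ul north = ul
flankType ll lr ul south = ll

vertexDegree : CellType → CellType → CellType → ℕ
vertexDegree ll lr ul = length (filter (λ e → T? (not (joined (sideOf e) (flankType ll lr ul e)))) directions)

Row : Set
Row = Maybe CellType × Maybe CellType × Maybe CellType

-- Three rows of three cell types, listed from the bottom row and the left column.
Window : Set
Window = Row × Row × Row

_≟ᵀ_ : DecidableEquality (Maybe CellType)
_≟ᵀ_ = Maybe.≡-dec (Product.≡-dec (Product.≡-dec ℙ._≟_ ℙ._≟_) _≟ᴵ_)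

_≟ᵂ_ : DecidableEquality Window
_≟ᵂ_ = Product.≡-dec row (Product.≡-dec row row)
  where row = Product.≡-dec _≟ᵀ_ (Product.≡-dec _≟ᵀ_ _≟ᵀ_)

open DecMembership _≟ᵂ_ using () renaming (_∈?_ to _∈ᵂ?_)

windowAt : ℕ → ℕ → ℕ → Window
windowAt n x y = row y , row (suc y) , row (suc (suc y))
  where row : ℕ → Row
        row y = typeAt n x y , typeAt n (suc x) y , typeAt n (suc (suc x)) y

cornerOf : Window → Parity → Parity → Maybe CellType
cornerOf ((a , b , _) , _)     0ℙ 0ℙ = a
cornerOf ((a , b , _) , _)     1ℙ 0ℙ = b
cornerOf (_ , (a , b , _) , _) 0ℙ 1ℙ = a
cornerOf (_ , (a , b , _) , _) 1ℙ 1ℙ = b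

childWindow : Window → Parity → Parity → Window
childWindow w p q = row 0 , row 1 , row 2
  where
  cell : ℕ → ℕ → Maybe CellType
  cell k l = Maybe.map (λ κ → childType κ (parity k) (parity l)) (cornerOf w (parity ⌊ k /2⌋) (parity ⌊ l /2⌋))
  row : ℕ → Row
  row j = cell (bit p) (bit q ℕ.+ j) , cell (1 ℕ.+ bit p) (bit q ℕ.+ j) , cell (2 ℕ.+ bit p) (bit q ℕ.+ j)

children : Window → List Window
children w = concatMap (λ p → map (childWindow w p) parities) parities

∈-children : ∀ w p q → childWindow w p q ∈ children w
∈-children w 0ℙ 0ℙ = here refl
∈-children w 0ℙ 1ℙ = there (here refl)
∈-children w 1ℙ 0ℙ = there (there (here refl))
∈-children w 1ℙ 1ℙ = there (there (there (here refl)))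

⌊suc/2⌋ : ∀ x → ⌊ suc x /2⌋ ≡ ⌊ suc (bit (parity x)) /2⌋ ℕ.+ ⌊ x /2⌋
⌊suc/2⌋ zero          = refl
⌊suc/2⌋ (suc zero)    = refl
⌊suc/2⌋ (suc (suc x)) = trans (cong suc (⌊suc/2⌋ x)) (sym (ℕ.+-suc _ ⌊ x /2⌋))

parity-suc : ∀ x → parity (suc x) ≡ parity (suc (bit (parity x)))
parity-suc zero          = refl
parity-suc (suc zero)    = refl
parity-suc (suc (suc x)) = parity-suc x

windowAt-suc : ∀ n x y → windowAt (suc n) x y ≡ childWindow (windowAt n ⌊ x /2⌋ ⌊ y /2⌋) (parity x) (parity y)
windowAt-suc n x y rewrite ⌊suc/2⌋ x | ⌊suc/2⌋ y | parity-suc x | parity-suc y with parity x | parity y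
... | 0ℙ | 0ℙ = refl
... | 0ℙ | 1ℙ = refl
... | 1ℙ | 0ℙ = refl
... | 1ℙ | 1ℙ = refl

insert : Window → List Window → List Window
insert w ws with w ∈ᵂ? ws
... | yes _ = ws
... | no _  = w ∷ ws

saturate : ℕ → List Window → List Window
saturate zero    ws = ws
saturate (suc k) ws = saturate k (foldr insert ws (concatMap children ws))

seeds : List Window
seeds = windowAt 0 0 0 ∷ windowAt 0 1 0 ∷ windowAt 0 0 1 ∷ windowAt 0 1 1 ∷ windowAt 0 2 0 ∷ []

windowAt-zero-seed : ∀ x y → windowAt 0 x y ∈ seeds
windowAt-zero-seed 0             0             = here refl
windowAt-zero-seed 1             0             = there (here refl)
windowAt-zero-seed 0             1             = there (there (here refl))
windowAt-zero-seed 1             1             = there (there (there (here refl)))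
windowAt-zero-seed (suc (suc x)) y             = there (there (there (there (here refl))))
windowAt-zero-seed 0             (suc (suc y)) = there (there (there (there (here refl))))
windowAt-zero-seed 1             (suc (suc y)) = there (there (there (there (here refl))))

-- Five rounds reach the fixed point, which is all that the closure check below needs.
legal : List Window
legal = saturate 5 seeds

_⊆ᵂ?_ : ∀ ws ws′ → Dec (All (_∈ ws′) ws)
ws ⊆ᵂ? ws′ = all? (_∈ᵂ? ws′) ws

ClosedUnderChildren : List Window → Set
ClosedUnderChildren ws = All (λ w → All (_∈ ws) (children w)) ws

closed? : ∀ ws → Dec (ClosedUnderChildren ws)
closed? ws = all? (λ w → children w ⊆ᵂ? ws) ws

seeds⊆legal : All (_∈ legal) seeds
seeds⊆legal = toWitness {a? = seeds ⊆ᵂ? legal} _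

legal-closed : ClosedUnderChildren legal
legal-closed = toWitness {a? = closed? legal} _

windowAt-legal : ∀ n x y → windowAt n x y ∈ legal
windowAt-legal zero    x y = All.lookup seeds⊆legal (windowAt-zero-seed x y)
windowAt-legal (suc n) x y =
  subst (_∈ legal) (sym (windowAt-suc n x y))
    (All.lookup (All.lookup legal-closed (windowAt-legal n ⌊ x /2⌋ ⌊ y /2⌋)) (∈-children _ (parity x) (parity y)))

-- Vertices (1,1), (2,1) and (1,2) of a window, joined by the top side of cell (1,0) and the
-- right side of cell (0,1) respectively.
horizontallyProper : Window → Bool
horizontallyProper ((just a , just b , just c) , (just d , just e , _) , _) =
  joined topSide b ∨ not (vertexDegree a b d ≡ᵇ vertexDegree b c e)
horizontallyProper _ = true

verticallyProper : Window → Bool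
verticallyProper ((just a , just b , _) , (just d , just e , _) , (just g , _ , _)) =
  joined rightSide d ∨ not (vertexDegree a b d ≡ᵇ vertexDegree d e g)
verticallyProper _ = true

Proper : Window → Set
Proper w = T (horizontallyProper w) × T (verticallyProper w)

legal-proper : All Proper legal
legal-proper = toWitness {a? = all? (λ w → T? (horizontallyProper w) ×-dec T? (verticallyProper w)) legal} _

proper⇒≢ : ∀ {j m n} → T (j ∨ not (m ≡ᵇ n)) → j ≡ false → m ≢ n
proper⇒≢ {m = m} proper refl refl with m ≡ᵇ m | ℕ.≡⇒≡ᵇ m m refl
... | true | _ = proper

horizontallyProper-sound : ∀ {a′ b′ c′ d′ e′ f r a b c d e} →
  T (horizontallyProper ((a′ , b′ , c′) , (d′ , e′ , f) , r)) →
  a′ ≡ just a → b′ ≡ just b → c′ ≡ just c → d′ ≡ just d → e′ ≡ just e →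
  joined topSide b ≡ false → vertexDegree a b d ≢ vertexDegree b c e
horizontallyProper-sound proper refl refl refl refl refl = proper⇒≢ proper

verticallyProper-sound : ∀ {a′ b′ d′ e′ g′ c f r a b d e g} →
  T (verticallyProper ((a′ , b′ , c) , (d′ , e′ , f) , (g′ , r))) →
  a′ ≡ just a → b′ ≡ just b → d′ ≡ just d → e′ ≡ just e → g′ ≡ just g →
  joined rightSide d ≡ false → vertexDegree a b d ≢ vertexDegree d e g
verticallyProper-sound proper refl refl refl refl refl = proper⇒≢ proper

-- σⁿ(L₀) has no cells at negative coordinates.
typeAtℤ : ℕ → Pt → Maybe CellType
typeAtℤ n (+ x , + y) = typeAt n x y
typeAtℤ n _           = nothing

horizontal-rule : ∀ n p {a b c d e} →
  typeAtℤ n ((+ 0 , + 0) ⊕ p) ≡ just a → typeAtℤ n ((+ 1 , + 0) ⊕ p) ≡ just b → typeAtℤ n ((+ 2 , + 0) ⊕ p) ≡ just c →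
  typeAtℤ n ((+ 0 , + 1) ⊕ p) ≡ just d → typeAtℤ n ((+ 1 , + 1) ⊕ p) ≡ just e →
  joined topSide b ≡ false → vertexDegree a b d ≢ vertexDegree b c e
horizontal-rule n (+ x , + y) = horizontallyProper-sound (proj₁ (All.lookup legal-proper (windowAt-legal n x y)))
horizontal-rule n (+ x , -[1+ y ]) ()
horizontal-rule n (-[1+ x ] , y)   ()

vertical-rule : ∀ n p {a b d e g} →
  typeAtℤ n ((+ 0 , + 0) ⊕ p) ≡ just a → typeAtℤ n ((+ 1 , + 0) ⊕ p) ≡ just b →
  typeAtℤ n ((+ 0 , + 1) ⊕ p) ≡ just d → typeAtℤ n ((+ 1 , + 1) ⊕ p) ≡ just e → typeAtℤ n ((+ 0 , + 2) ⊕ p) ≡ just g →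
  joined rightSide d ≡ false → vertexDegree a b d ≢ vertexDegree d e g
vertical-rule n (+ x , + y) = verticallyProper-sound (proj₂ (All.lookup legal-proper (windowAt-legal n x y)))
vertical-rule n (+ x , -[1+ y ]) ()
vertical-rule n (-[1+ x ] , y)   ()

-- Cell types in a chair tiling

cellOf-translate : ∀ w s i → cellOf (translate w s) i ≡ cellOf s i ⊕ dbl w
cellOf-translate w s i = ⊕-dbl-⊕ (Q s · L₀cell i) (b s) w

inside-translate : ∀ w s c → Inside (translate w s) c ⇔ Inside s (c ⊖ w)
inside-translate w s c = mk⇔
  (λ c∈ → let i , eq = to (inside⇔cellOf (translate w s) c) c∈ in from (inside⇔cellOf s (c ⊖ w)) (i , shift-out {i} eq))
  (λ c∈ → let i , eq = to (inside⇔cellOf s (c ⊖ w)) c∈ in from (inside⇔cellOf (translate w s) c) (i , shift-in {i} eq))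
  where
  open Equivalence
  shift-out : ∀ {i} → cellCode c ≡ cellOf (translate w s) i → cellCode (c ⊖ w) ≡ cellOf s i
  shift-out {i} eq = trans (cellCode-⊖ c w) (sym (to (⊕≡⇔≡⊖ {cellOf s i} {dbl w}) (sym (trans eq (cellOf-translate w s i)))))
  shift-in : ∀ {i} → cellCode (c ⊖ w) ≡ cellOf s i → cellCode c ≡ cellOf (translate w s) i
  shift-in {i} eq = trans (sym (from (⊕≡⇔≡⊖ {cellOf s i} {dbl w}) (trans (sym eq) (cellCode-⊖ c w)))) (sym (cellOf-translate w s i))

inside-across : ∀ s c i o → cellCode c ≡ cellOf s i → Inside s (c ⊕ o) ⇔ ((Q s · L₀cell i) ⊕ dbl o) ∈ shapeCells (Q s)
inside-across s c i o code≡ =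
  subst (λ k → Inside s (c ⊕ o) ⇔ k ∈ shapeCells (Q s)) shifted (∈-map-⊕⇔ {cellCode (c ⊕ o)} {dbl (b s)} {shapeCells (Q s)})
  where
  shifted : cellCode (c ⊕ o) ⊖ dbl (b s) ≡ (Q s · L₀cell i) ⊕ dbl o
  shifted = trans (cong (_⊖ dbl (b s)) (trans (cellCode-⊕ c o) (cong (_⊕ dbl o) code≡)))
                  (⊕-⊕-⊖-cancel (Q s · L₀cell i) (dbl (b s)) (dbl o))

¬T⇔T-not : ∀ j → (¬ T j) ⇔ T (not j)
¬T⇔T-not true  = mk⇔ (λ notTrue → notTrue _) (λ ())
¬T⇔T-not false = mk⇔ _ (λ _ ())

module Typing {𝒯 : Tile → Set} (tiling : ChairTiling 𝒯) where
  open ChairTiling tiling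
  open Tiling tiling
  open Equivalence

  Typed : ℕ → Pt → Pt → CellType → Set
  Typed n w c κ = typeAtℤ n (c ⊖ w) ≡ just κ × (∀ s → Inside (tileOf c) (c ⊕ step s) ⇔ T (joined s κ))

  typedVia : ∀ {n w c} s → Labelled n s → SameTile (tileOf c) (translate w s) → ∃[ κ ] Typed n w c κ
  typedVia {n} {w} {c} s (r , Q≡ , placed) same
    with to (inside⇔cellOf s (c ⊖ w)) (to (inside-translate w s c) (to (same (cellCode c)) (inside-tileOf c)))
  ... | i , code≡ with placed i
  ... | x , y , cell≡ , type≡ = (r , i) , position , joined⇔
    where
    position : typeAtℤ n (c ⊖ w) ≡ just (r , i)
    position = trans (cong (typeAtℤ n) (cellCode-injective {c ⊖ w} {+ x , + y} (trans code≡ cell≡))) type≡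
    joined⇔ : ∀ side → Inside (tileOf c) (c ⊕ step side) ⇔ T (joined side (r , i))
    joined⇔ side = begin
      Inside (tileOf c) (c ⊕ step side)                        ∼⟨ same (cellCode (c ⊕ step side)) ⟩
      Inside (translate w s) (c ⊕ step side)                   ∼⟨ inside-translate w s (c ⊕ step side) ⟩
      Inside s ((c ⊕ step side) ⊖ w)                           ≡⟨ cong (Inside s) (⊕-⊖-comm c (step side) w) ⟩
      Inside s ((c ⊖ w) ⊕ step side)                           ∼⟨ inside-across s (c ⊖ w) i (step side) code≡ ⟩
      ((Q s · L₀cell i) ⊕ dbl (step side)) ∈ shapeCells (Q s) ≡⟨ cong (λ M → ((M · L₀cell i) ⊕ dbl (step side)) ∈ shapeCells M) Q≡ ⟩
      SameTileAcross r i side                                  ∼⟨ joined-correct r i side ⟩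
      T (joined side (r , i))                                  ∎
      where open EquationalReasoning {k = equivalence}

  typedPatch : ∀ c os → ∃₂ λ n w → All (λ o → ∃[ κ ] Typed n w (c ⊕ o) κ) os
  typedPatch c os with chair (map (λ o → tileOf (c ⊕ o)) os) (All.map⁺ (All.tabulate (λ {o} _ → tileOf∈𝒯 (c ⊕ o))))
  ... | n , w , found = n , w , All.map typed (All.map⁻ found)
    where
    typed : ∀ {c} → Any (λ s → SameTile (tileOf c) (translate w s)) (σ^ n) → ∃[ κ ] Typed n w c κ
    typed found = let labelled , same = All.lookupAny (σ^-labelled n) found in typedVia (Any.lookup found) labelled same

  crosses⇔ : ∀ {n w κ} v e → Typed n w (v ⊕ flank e) κ → Crosses v e ⇔ T (not (joined (sideOf e) κ))
  crosses⇔ {κ = κ} v e (_ , joined⇔) = mk⇔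
    (λ crosses → to (¬T⇔T-not j) (crosses ∘ subst (Inside t) reassoc ∘ from (joined⇔ (sideOf e))))
    (λ notJoined → from (¬T⇔T-not j) notJoined ∘ to (joined⇔ (sideOf e)) ∘ subst (Inside t) (sym reassoc))
    where
    t = tileOf (v ⊕ flank e)
    j = joined (sideOf e) κ
    reassoc : (v ⊕ flank e) ⊕ step (sideOf e) ≡ v ⊕ opposite e
    reassoc = ⊕-assoc v (flank e) (step (sideOf e))

  degree≡vertexDegree : ∀ {n w ll lr ul} v →
    Typed n w (v ⊕ flank west) ll → Typed n w (v ⊕ flank east) lr → Typed n w (v ⊕ flank north) ul →
    degree v ≡ vertexDegree ll lr ul
  degree≡vertexDegree {n} {w} {ll} {lr} {ul} v typedˡˡ typedˡʳ typedᵘˡ =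
    cong length (filter-≐ (crosses? v) (λ e → T? _)
                          ((λ {e} → to (crosses⇔ v e (typedFlank e))) , (λ {e} → from (crosses⇔ v e (typedFlank e))))
                          directions)
    where
    typedFlank : ∀ e → Typed n w (v ⊕ flank e) (flankType ll lr ul e)
    typedFlank east  = typedˡʳ
    typedFlank west  = typedˡˡ
    typedFlank north = typedᵘˡ
    typedFlank south = typedˡˡ

  -- The patches below are read in window coordinates whose cell (0,0) is u ⊕ flank west.
  rebased : ∀ {n w κ} u {o} → Typed n w (u ⊕ o) κ → typeAtℤ n ((o ⊖ flank west) ⊕ ((u ⊕ flank west) ⊖ w)) ≡ just κ
  rebased {n} {w} u {o} (position , _) = trans (cong (typeAtℤ n) (sym (⊕-⊖-rebase u o (flank west) w))) position

  reassociated : ∀ {n w κ} u v o → Typed n w (u ⊕ (v ⊕ o)) κ → Typed n w ((u ⊕ v) ⊕ o) κ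
  reassociated {n} {w} u v o = subst (λ c → Typed n w c _) (sym (⊕-assoc u v o))

  degree≢east : ∀ u → G₁ 𝒯 u (u ⊕ unit east) → degree u ≢ degree (u ⊕ unit east)
  degree≢east u edge = fromPatch (typedPatch u offsets)
    where
    offsets = flank west ∷ flank east ∷ (+ 1 , - + 1) ∷ flank north ∷ (+ 0 , + 0) ∷ []
    fromPatch : (∃₂ λ n w → All (λ o → ∃[ κ ] Typed n w (u ⊕ o) κ) offsets) → degree u ≢ degree (u ⊕ unit east)
    fromPatch (n , w , (κ₀₀ , t₀₀) ∷ (κ₁₀ , t₁₀) ∷ (κ₂₀ , t₂₀) ∷ (κ₀₁ , t₀₁) ∷ (κ₁₁ , t₁₁) ∷ []) degrees≡ =
      horizontal-rule n ((u ⊕ flank west) ⊖ w)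
        (rebased u t₀₀) (rebased u t₁₀) (rebased u t₂₀) (rebased u t₀₁) (rebased u t₁₁)
        (to T-not-≡ (to (crosses⇔ u east t₁₀) (to (edge⇔crosses u east) edge)))
        (begin
          vertexDegree κ₀₀ κ₁₀ κ₀₁  ≡⟨ sym (degree≡vertexDegree u t₀₀ t₁₀ t₀₁) ⟩
          degree u                  ≡⟨ degrees≡ ⟩
          degree (u ⊕ unit east)    ≡⟨ degree≡vertexDegree (u ⊕ unit east) (moved t₁₀) (moved t₂₀) (moved t₁₁) ⟩
          vertexDegree κ₁₀ κ₂₀ κ₁₁  ∎)
      where
      open ≡-Reasoning
      moved : ∀ {o κ} → Typed n w (u ⊕ (unit east ⊕ o)) κ → Typed n w ((u ⊕ unit east) ⊕ o) κ
      moved {o} = reassociated u (unit east) o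

  degree≢north : ∀ u → G₁ 𝒯 u (u ⊕ unit north) → degree u ≢ degree (u ⊕ unit north)
  degree≢north u edge = fromPatch (typedPatch u offsets)
    where
    offsets = flank west ∷ flank east ∷ flank north ∷ (+ 0 , + 0) ∷ (- + 1 , + 1) ∷ []
    fromPatch : (∃₂ λ n w → All (λ o → ∃[ κ ] Typed n w (u ⊕ o) κ) offsets) → degree u ≢ degree (u ⊕ unit north)
    fromPatch (n , w , (κ₀₀ , t₀₀) ∷ (κ₁₀ , t₁₀) ∷ (κ₀₁ , t₀₁) ∷ (κ₁₁ , t₁₁) ∷ (κ₀₂ , t₀₂) ∷ []) degrees≡ =
      vertical-rule n ((u ⊕ flank west) ⊖ w)
        (rebased u t₀₀) (rebased u t₁₀) (rebased u t₀₁) (rebased u t₁₁) (rebased u t₀₂)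
        (to T-not-≡ (to (crosses⇔ u north t₀₁) (to (edge⇔crosses u north) edge)))
        (begin
          vertexDegree κ₀₀ κ₁₀ κ₀₁  ≡⟨ sym (degree≡vertexDegree u t₀₀ t₁₀ t₀₁) ⟩
          degree u                  ≡⟨ degrees≡ ⟩
          degree (u ⊕ unit north)   ≡⟨ degree≡vertexDegree (u ⊕ unit north) (moved t₀₁) (moved t₁₁) (moved t₀₂) ⟩
          vertexDegree κ₀₁ κ₁₁ κ₀₂  ∎)
      where
      open ≡-Reasoning
      moved : ∀ {o κ} → Typed n w (u ⊕ (unit north ⊕ o)) κ → Typed n w ((u ⊕ unit north) ⊕ o) κ
      moved {o} = reassociated u (unit north) o

  adjacent⇒degree≢ : ∀ {u v} → G₁ 𝒯 u v → degree u ≢ degree v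
  adjacent⇒degree≢ {u} edge = along (unitApart⇒unit {u} (proj₁ edge)) edge
    where
    flipped : ∀ e → G₁ 𝒯 u (u ⊕ unit e) → G₁ 𝒯 (u ⊕ unit e) ((u ⊕ unit e) ⊕ unit (reverse e))
    flipped e edge = subst (G₁ 𝒯 _) (sym (⊕-unit-reverse u e)) (G₁-sym edge)
    back : ∀ e → degree ((u ⊕ unit e) ⊕ unit (reverse e)) ≡ degree u
    back e = cong degree (⊕-unit-reverse u e)
    along : ∀ {v} → ∃[ e ] v ≡ u ⊕ unit e → G₁ 𝒯 u v → degree u ≢ degree v
    along (east  , refl) edge = degree≢east u edge
    along (north , refl) edge = degree≢north u edge
    along (west  , refl) edge = λ eq → degree≢east _ (flipped west edge) (trans (sym eq) (sym (back west)))
    along (south , refl) edge = λ eq → degree≢north _ (flipped south edge) (trans (sym eq) (sym (back south)))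


sum-map-const : ∀ {A : Set} c (xs : List A) → sum (map (λ _ → c) xs) ≡ length xs ℕ.* c
sum-map-const c []       = refl
sum-map-const c (x ∷ xs) = cong (c ℕ.+_) (sum-map-const c xs)

weightedDegree-const : ∀ {E u c s} → WeightedDegree E (λ _ _ → c) u s → ∃[ k ] (Degree E u k × s ≡ k ℕ.* c)
weightedDegree-const {c = c} (ns , neighbourList , refl) = length ns , (ns , neighbourList , refl) , sum-map-const c ns

proposition4p2 : (T : Tile → Set) → ChairTiling T →
    (∀ u → ∃[ k ] Degree (G₁ T) u k)
    × (∀ u v → G₁ T u v → ∀ k m → Degree (G₁ T) u k → Degree (G₁ T) v m → k ≢ m)
    × (∀ (c : ℕ) → 1 ≤ c → c ≤ 3 → Solution123 (G₁ T) (λ _ _ → c))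
proposition4p2 T tiling = (λ u → degree u , hasDegree u) , degrees-differ , constant-solution
  where
  open Tiling tiling
  open Typing tiling

  degree-of : ∀ {u k} → Degree (G₁ T) u k → k ≡ degree u
  degree-of {u} has-k = degree-functional {G₁ T} {u} has-k (hasDegree u)

  degrees-differ : ∀ u v → G₁ T u v → ∀ k m → Degree (G₁ T) u k → Degree (G₁ T) v m → k ≢ m
  degrees-differ u v edge k m has-k has-m k≡m =
    adjacent⇒degree≢ edge (trans (sym (degree-of has-k)) (trans k≡m (degree-of has-m)))

  constant-solution : ∀ c → 1 ≤ c → c ≤ 3 → Solution123 (G₁ T) (λ _ _ → c)
  constant-solution c 1≤c c≤3 = (λ _ _ _ → refl) , (λ _ _ _ → 1≤c , c≤3) , weighted-degrees-differ
    where
    weighted-degrees-differ : ∀ u v → G₁ T u v → ∀ s s′ → WeightedDegree (G₁ T) (λ _ _ → c) u s →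
                              WeightedDegree (G₁ T) (λ _ _ → c) v s′ → s ≢ s′
    weighted-degrees-differ u v edge s s′ ws ws′ s≡s′
      with weightedDegree-const {G₁ T} {u} ws | weightedDegree-const {G₁ T} {v} ws′
    ... | k , has-k , refl | m , has-m , refl =
      degrees-differ u v edge k m has-k has-m (ℕ.*-cancelʳ-≡ k m c {{ℕ.>-nonZero 1≤c}} s≡s′)
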